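{- Let $b\ge2$, let $N$ be a positive integer with $\gcd(N,b)=1$, and let $p$ be a prime divisor of $b-1$. Then there exists a positive integer $s$ such that $\mathcal{M}_b(p^tN)=\varnothing$ for every integer $t>s$.
   Context: $|b|_N$ denotes the multiplicative order of $b$ modulo $N$ (for $\gcd(N,b)=1$), and $\mathbb{U}_N=\{x: 1\le x<N,\ \gcd(x,N)=1\}$. Midy's set: for an integer $d\ge 2$ dividing $|b|_N$, put $L=|b|_N$ and $k=L/d$. For $x\in\mathbb{U}_N$, let $a_1\cdots a_L$ be the base-$b$ digits (padded with leading zeros to exactly $L$ digits) of the integer $x(b^L-1)/N$ (the period of the base-$b$ expansion of $x/N$). For $j=1,\dots,d$ let $A_j=[a_{(j-1)k+1}\cdots a_{jk}]_b$ be the integer with the $j$-th block of $k$ digits, and $S_d(x)=\sum_{j=1}^d A_j$. $N$ has the Midy property for $b$ and $d$ if $b^k-1\mid S_d(x)$ for all $x\in\mathbb{U}_N$; the Midy set $\mathcal{M}_b(N)$ is the set of integers $d\ge2$ dividing $|b|_N$ for which this holds. -}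

module Defs where

open import Data.Nat using (ℕ; zero; suc; _+_; _*_; _∸_; _^_; _≤_; _<_; NonZero)
open import Data.Nat.Properties using (m^n≢0)
open import Data.Nat.DivMod using (_/_; _%_)
open import Data.Nat.Divisibility using (_∣_)
open import Data.Nat.Coprimality using (Coprime)
open import Data.Product using (_×_)
open import Relation.Binary.PropositionalEquality using (_≡_)

sum1 : ℕ → (ℕ → ℕ) → ℕ
sum1 zero    f = 0
sum1 (suc n) f = sum1 n f + f (suc n)

IsOrder : ℕ → ℕ → ℕ → Set
IsOrder b N L = 0 < L × N ∣ (b ^ L ∸ 1) × (∀ m → 0 < m → N ∣ (b ^ m ∸ 1) → L ≤ m)

-- i-th base-b digit (i = 1..L, most significant first) of X written with exactly L digits
digit : (b : ℕ) .{{_ : NonZero b}} → (L X i : ℕ) → ℕ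
digit b L X i = (_/_ X (b ^ (L ∸ i)) {{m^n≢0 b (L ∸ i)}}) % b

block : (b : ℕ) .{{_ : NonZero b}} → (L k X j : ℕ) → ℕ
block b L k X j = sum1 k (λ i → digit b L X ((j ∸ 1) * k + i) * b ^ (k ∸ i))

-- S_d(x) = Σ_{j=1}^{d} A_j, where X = x(b^L - 1)/N
S : (b : ℕ) .{{_ : NonZero b}} → (L k d X : ℕ) → ℕ
S b L k d X = sum1 d (λ j → block b L k X j)

-- Midy property of N for b and d, where L = |b|_N and k = L/d
-- (k is characterised by L = k * d, X by X * N = x (b^L - 1))
HasMidy : (b : ℕ) .{{_ : NonZero b}} → (N L d : ℕ) → Set
HasMidy b N L d =
  ∀ k → L ≡ k * d →
  ∀ x → 1 ≤ x → x < N → Coprime x N →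
  ∀ X → X * N ≡ x * (b ^ L ∸ 1) →
  (b ^ k ∸ 1) ∣ S b L k d X

InMidySet : (b : ℕ) .{{_ : NonZero b}} → (N L d : ℕ) → Set
InMidySet b N L d = 2 ≤ d × d ∣ L × HasMidy b N L d

module Submission where

-- Write E m = b ^ m - 1, Q = p ^ t · N and let L be the order of b modulo Q.
-- (1) Midy ⇒ extra factor.  If d ∈ M_b(Q) with L = k d, apply the Midy property to x = 1:
--     b ^ k - 1 divides S_d(X) for the period X = E L / Q, and X ≡ S_d(X) (mod b ^ k - 1)
--     because b ^ k ≡ 1; hence (b ^ k - 1) · Q ∣ E L, and since p ∣ b - 1 ∣ b ^ k - 1 we get
--     p · Q ∣ E L.  Writing N = p ^ γ · N₀ with p ∤ N₀, this says p ^ (t + γ + 1) ∣ E L.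
-- (2) No extra factor for large t.  Write L = p ^ a · r with p ∤ r.  Lifting the exponent
--     (via the geometric sum (1 + u) ^ n - 1 = u · (1 + (1 + u) + ⋯)) gives p ^ (t + γ + 1) ∣ E (p ^ a),
--     and the p-adic valuation of E (p ^ a) is below a + b ^ p, so a is large.  Then one factor p can
--     be removed from the exponent: p ^ (t + γ) ∣ E (p ^ (a - 1)).  If M = p ^ c · M' (p ∤ M') is a
--     period of b modulo N and t > b ^ p + c, then Q already divides E (p ^ (a - 1) · r · M'),
--     so L divides p ^ (a - 1) · r · M', forcing p ∣ M': a contradiction.

open import Defs
open import Data.Nat
open import Data.Nat.Properties
open import Data.Nat.Divisibility
open import Data.Nat.DivMod
open import Data.Nat.Coprimality using (Coprime; coprime-divisor)
open import Data.Nat.Primality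
open import Data.Nat.Induction using (<-wellFounded)
open import Data.Nat.Tactic.RingSolver using (solve-∀)
open import Data.Fin using (Fin; toℕ)
open import Data.Fin.Properties using (pigeonhole; toℕ-fromℕ<)
open import Data.Product
open import Data.Sum using (inj₁; inj₂)
open import Data.Empty using (⊥; ⊥-elim)
open import Induction.WellFounded using (Acc; acc)
open import Relation.Binary.PropositionalEquality
open import Relation.Nullary using (¬_; yes; no)

geomSum : ℕ → ℕ → ℕ
geomSum zero    w = 0
geomSum (suc n) w = 1 + w * geomSum n w

suc-pow-geom : ∀ u n → suc u ^ n ≡ suc (u * geomSum n (suc u))
suc-pow-geom u zero    = cong suc (sym (*-zeroʳ u))
suc-pow-geom u (suc n) = begin
    suc u * suc u ^ n                      ≡⟨ cong (suc u *_) (suc-pow-geom u n) ⟩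
    suc u * suc (u * geomSum n (suc u))    ≡⟨ expand u (geomSum n (suc u)) ⟩
    suc (u * geomSum (suc n) (suc u))      ∎
  where
  open ≡-Reasoning
  expand : ∀ u g → suc u * suc (u * g) ≡ suc (u * (1 + suc u * g))
  expand = solve-∀

suc-pow∸1 : ∀ u n → suc u ^ n ∸ 1 ≡ u * geomSum n (suc u)
suc-pow∸1 u n = cong (_∸ 1) (suc-pow-geom u n)

-- Modulo any divisor q of u, each term of geomSum n (1 + u) is 1, so the sum is n.
geomSum-mod : ∀ q u n → q ∣ u → ∃ λ K → geomSum n (suc u) ≡ n + K * q
geomSum-mod q u zero    _              = 0 , refl
geomSum-mod q u (suc n) (divides c refl) with geomSum-mod q (c * q) n (divides c refl)
... | K , eq = c * (n + K * q) + K , trans (cong (λ g → 1 + suc (c * q) * g) eq) (expand c q n K)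
  where
  expand : ∀ c q n K → 1 + suc (c * q) * (n + K * q) ≡ suc n + (c * (n + K * q) + K) * q
  expand = solve-∀

pow-suc-pred : ∀ w m → 1 ≤ w → w ^ m ≡ suc (w ^ m ∸ 1)
pow-suc-pred w m w≥1 = trans (sym (m∸n+n≡m 1≤w^m)) (+-comm (w ^ m ∸ 1) 1)
  where
  1≤w^m : 1 ≤ w ^ m
  1≤w^m = subst (_≤ w ^ m) (^-zeroˡ m) (^-monoˡ-≤ m w≥1)

pow-*∸1 : ∀ w m n → 1 ≤ w → w ^ (m * n) ∸ 1 ≡ suc (w ^ m ∸ 1) ^ n ∸ 1
pow-*∸1 w m n w≥1 = cong (_∸ 1) (trans (sym (^-*-assoc w m n)) (cong (_^ n) (pow-suc-pred w m w≥1)))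

pow∸1-∣ : ∀ w m n → 1 ≤ w → (w ^ m ∸ 1) ∣ (w ^ (m * n) ∸ 1)
pow∸1-∣ w m n w≥1 = divides (geomSum n (suc u)) (begin
    w ^ (m * n) ∸ 1       ≡⟨ pow-*∸1 w m n w≥1 ⟩
    suc u ^ n ∸ 1         ≡⟨ suc-pow∸1 u n ⟩
    u * geomSum n (suc u) ≡⟨ *-comm u _ ⟩
    geomSum n (suc u) * u ∎)
  where
  open ≡-Reasoning
  u = w ^ m ∸ 1

pow-+∸1 : ∀ w m n → 1 ≤ w → w ^ (m + n) ∸ 1 ≡ w ^ m * (w ^ n ∸ 1) + (w ^ m ∸ 1)
pow-+∸1 w m n w≥1 = begin
    w ^ (m + n) ∸ 1              ≡⟨ cong (_∸ 1) (^-distribˡ-+-* w m n) ⟩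
    w ^ m * w ^ n ∸ 1            ≡⟨ cong₂ (λ x y → x * y ∸ 1) (pow-suc-pred w m w≥1) (pow-suc-pred w n w≥1) ⟩
    suc x * suc y ∸ 1            ≡⟨ expand x y ⟩
    suc x * y + x                ≡⟨ cong (λ z → z * y + x) (sym (pow-suc-pred w m w≥1)) ⟩
    w ^ m * y + x                ∎
  where
  open ≡-Reasoning
  x = w ^ m ∸ 1
  y = w ^ n ∸ 1
  expand : ∀ x y → y + x * suc y ≡ suc x * y + x
  expand = solve-∀

pow-∣-pow : ∀ p {m n} → m ≤ n → p ^ m ∣ p ^ n
pow-∣-pow p {m} {n} m≤n = divides (p ^ (n ∸ m))
  (trans (cong (p ^_) (sym (m+[n∸m]≡n m≤n))) (trans (^-distribˡ-+-* p m (n ∸ m)) (*-comm (p ^ m) _)))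

lt-pow : ∀ p n → 2 ≤ p → n < p ^ n
lt-pow p zero    _   = z<s
lt-pow p (suc n) p≥2 = begin-strict
  suc n            ≤⟨ lt-pow p n p≥2 ⟩
  p ^ n            <⟨ m<m*n (p ^ n) p {{m^n≢0 p n {{>-nonZero (<-trans z<s p≥2)}}}} p≥2 ⟩
  p ^ n * p        ≡⟨ *-comm (p ^ n) p ⟩
  p ^ suc n        ∎
  where open ≤-Reasoning

-- Every m with Q ∣ w ^ m - 1 is a multiple of the multiplicative order of w modulo Q:
-- Q also divides w ^ (m mod L) - 1, which forces m mod L = 0 by minimality of L.
order-∣ : ∀ w Q L m → 1 ≤ w → IsOrder w Q L → Q ∣ (w ^ m ∸ 1) → L ∣ m
order-∣ w Q L m w≥1 (L>0 , Q∣L , minimal) Q∣m = remainder-zero (m % L) refl Q∣r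
  where
  instance
    _ : NonZero L
    _ = >-nonZero L>0
  r = m % L
  q = m / L
  Q∣qL : Q ∣ (w ^ (q * L) ∸ 1)
  Q∣qL = ∣-trans Q∣L (subst (λ e → (w ^ L ∸ 1) ∣ (w ^ e ∸ 1)) (*-comm L q) (pow∸1-∣ w L q w≥1))
  Q∣r : Q ∣ (w ^ r ∸ 1)
  Q∣r = ∣m+n∣m⇒∣n (subst (Q ∣_) (pow-+∸1 w r (q * L) w≥1)
          (subst (λ e → Q ∣ (w ^ e ∸ 1)) (m≡m%n+[m/n]*n m L) Q∣m)) (∣n⇒∣m*n (w ^ r) Q∣qL)
  remainder-zero : ∀ e → e ≡ r → Q ∣ (w ^ e ∸ 1) → L ∣ m
  remainder-zero zero    e≡r _   = m%n≡0⇒n∣m m L (sym e≡r)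
  remainder-zero (suc e) e≡r Q∣e =
    ⊥-elim (<⇒≱ (subst (_< L) (sym e≡r) (m%n<n m L)) (minimal (suc e) z<s Q∣e))

prime≥2 : ∀ {p} → Prime p → 2 ≤ p
prime≥2 {p} pp = nonTrivial⇒n>1 p {{prime⇒nonTrivial pp}}

prime-pow-∣-cancel : ∀ p g x h → Prime p → ¬ p ∣ h → p ^ g ∣ x * h → p ^ g ∣ x
prime-pow-∣-cancel p zero    x h _  _   _ = 1∣ x
prime-pow-∣-cancel p (suc g) x h pp p∤h pg∣xh
  with euclidsLemma x h pp (∣-trans (m∣m*n (p ^ g)) pg∣xh)
... | inj₂ p∣h = ⊥-elim (p∤h p∣h)
... | inj₁ (divides c refl) =
  subst (_∣ c * p) (*-comm (p ^ g) p) (*-monoˡ-∣ p (prime-pow-∣-cancel p g c h pp p∤h pg∣ch))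
  where
  instance
    _ : NonZero p
    _ = prime⇒nonZero pp
  pg∣ch : p ^ g ∣ c * h
  pg∣ch = *-cancelˡ-∣ p (subst (p * p ^ g ∣_) (reassoc c p h) pg∣xh)
    where
    reassoc : ∀ c p h → c * p * h ≡ p * (c * h)
    reassoc = solve-∀

p-split : ∀ p → 2 ≤ p → ∀ n → 0 < n → ∃₂ λ c r → n ≡ p ^ c * r × ¬ p ∣ r
p-split p p≥2 n = go n (<-wellFounded n)
  where
  go : ∀ n → Acc _<_ n → 0 < n → ∃₂ λ c r → n ≡ p ^ c * r × ¬ p ∣ r
  go n (acc rec) n>0 with p ∣? n
  ... | no  p∤n = 0 , n , sym (+-identityʳ n) , p∤n
  ... | yes (divides zero refl) = ⊥-elim (<-irrefl refl n>0)
  ... | yes (divides n'@(suc _) refl) with go n' (rec (m<m*n n' p p≥2)) z<s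
  ... | c , r , n'≡ , p∤r = suc c , r , trans (cong (_* p) n'≡) (reassoc p (p ^ c) r) , p∤r
    where
    reassoc : ∀ p a r → a * r * p ≡ p * a * r
    reassoc = solve-∀

-- Lifting the exponent, coprime exponent: if p ∣ u and p ∤ r, then (1 + u) ^ r - 1
-- carries no more factors p than u, since its cofactor geomSum r (1 + u) ≡ r (mod p).
lte-coprime-exponent : ∀ p u r g → Prime p → p ∣ u → ¬ p ∣ r →
  p ^ g ∣ (suc u ^ r ∸ 1) → p ^ g ∣ u
lte-coprime-exponent p u r g pp p∣u p∤r pg∣ with geomSum-mod p u r p∣u
... | K , G≡ = prime-pow-∣-cancel p g u (geomSum r (suc u)) pp p∤G (subst (p ^ g ∣_) (suc-pow∸1 u r) pg∣)
  where
  p∤G : ¬ p ∣ geomSum r (suc u)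
  p∤G p∣G = p∤r (∣m+n∣m⇒∣n (subst (p ∣_) (trans G≡ (+-comm r (K * p))) p∣G) (n∣m*n K))

lte-prime-exponent-≥ : ∀ p u → p ∣ u → p * p ∣ (suc u ^ p ∸ 1)
lte-prime-exponent-≥ p u p∣u with geomSum-mod p u p p∣u
... | K , G≡ = subst (p * p ∣_) (sym (suc-pow∸1 u p))
  (*-pres-∣ p∣u (subst (p ∣_) (sym G≡) (∣m∣n⇒∣m+n ∣-refl (n∣m*n K))))

-- Lifting the exponent, exponent p, upper bound: if p² ∣ u then (1 + u) ^ p - 1
-- carries exactly one factor p more than u, since then geomSum p (1 + u) ≡ p (mod p²).
lte-prime-exponent-≤ : ∀ p u g → Prime p → p * p ∣ u →
  p ^ suc g ∣ (suc u ^ p ∸ 1) → p ^ g ∣ u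
lte-prime-exponent-≤ p u g pp p²∣u pg∣ with geomSum-mod (p * p) u p p²∣u
... | K , G≡ = prime-pow-∣-cancel p g u (1 + K * p) pp p∤1+Kp pg∣u[1+Kp]
  where
  instance
    _ : NonZero p
    _ = prime⇒nonZero pp
  factor : ∀ p u K → u * (p + K * (p * p)) ≡ p * (u * (1 + K * p))
  factor = solve-∀
  pg∣u[1+Kp] : p ^ g ∣ u * (1 + K * p)
  pg∣u[1+Kp] = *-cancelˡ-∣ p (subst (p ^ suc g ∣_)
    (trans (suc-pow∸1 u p) (trans (cong (u *_) G≡) (factor p u K))) pg∣)
  p∤1+Kp : ¬ p ∣ 1 + K * p
  p∤1+Kp p∣ = <⇒≢ (prime≥2 pp)
    (sym (∣1⇒≡1 (∣m+n∣m⇒∣n (subst (p ∣_) (+-comm 1 (K * p)) p∣) (n∣m*n K))))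

prime-pow-*-∣ : ∀ p t γ N₀ x → Prime p → ¬ p ∣ N₀ →
  p ^ (t + γ) ∣ x → p ^ γ * N₀ ∣ x → p ^ t * (p ^ γ * N₀) ∣ x
prime-pow-*-∣ p t γ N₀ x pp p∤N₀ p^T∣x (divides z refl) =
  *-monoˡ-∣ (p ^ γ * N₀) p^t∣z
  where
  instance
    _ : NonZero (p ^ γ)
    _ = m^n≢0 p γ {{prime⇒nonZero pp}}
  regroup : ∀ z g n → z * (g * n) ≡ z * n * g
  regroup = solve-∀
  p^t∣zN₀ : p ^ t ∣ z * N₀
  p^t∣zN₀ = *-cancelʳ-∣ (p ^ γ) (subst₂ _∣_ (^-distribˡ-+-* p t γ) (regroup z (p ^ γ) N₀) p^T∣x)
  p^t∣z : p ^ t ∣ z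
  p^t∣z = prime-pow-∣-cancel p t z N₀ pp p∤N₀ p^t∣zN₀

∤⇒nonZero : ∀ {p} r → ¬ p ∣ r → NonZero r
∤⇒nonZero {p} zero    p∤0 = ⊥-elim (p∤0 (p ∣0))
∤⇒nonZero     (suc r) _   = _

pow-suc-∣⇒∣ : ∀ p a r M .{{_ : NonZero p}} .{{_ : NonZero r}} → p ^ suc a * r ∣ p ^ a * (r * M) → p ∣ M
pow-suc-∣⇒∣ p a r M ∣m = *-cancelˡ-∣ (p ^ a * r) {{m*n≢0 (p ^ a) r {{m^n≢0 p a}}}}
  (subst₂ _∣_ (regroup p (p ^ a) r) (sym (*-assoc (p ^ a) r M)) ∣m)
  where
  regroup : ∀ p x r → p * x * r ≡ x * r * p
  regroup = solve-∀

coprime-pow-∣ : ∀ N a i y → Coprime N a → N ∣ a ^ i * y → N ∣ y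
coprime-pow-∣ N a zero    y _   N∣ = subst (N ∣_) (+-identityʳ y) N∣
coprime-pow-∣ N a (suc i) y cop N∣ =
  coprime-pow-∣ N a i y cop (coprime-divisor cop (subst (N ∣_) (*-assoc a (a ^ i) y) N∣))

≡-mod⇒∣ : ∀ N .{{_ : NonZero N}} x e → x % N ≡ (x * suc e) % N → N ∣ x * e
≡-mod⇒∣ N x e x≡y = ∣m+n∣m⇒∣n (divides (y / N) (+-cancelˡ-≡ (x % N) _ _ (begin
    x % N + (x / N * N + x * e)  ≡⟨ +-assoc (x % N) _ _ ⟨
    x % N + x / N * N + x * e    ≡⟨ cong (_+ x * e) (m≡m%n+[m/n]*n x N) ⟨
    x + x * e                    ≡⟨ expand x e ⟨
    y                            ≡⟨ m≡m%n+[m/n]*n y N ⟩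
    y % N + y / N * N            ≡⟨ cong (_+ y / N * N) x≡y ⟨
    x % N + y / N * N            ∎))) (n∣m*n (x / N))
  where
  open ≡-Reasoning
  y = x * suc e
  expand : ∀ x e → x * suc e ≡ x + x * e
  expand = solve-∀

-- If w is prime to N > 0, some positive power of w is ≡ 1 (mod N): two of the N + 1
-- residues w ^ 0, …, w ^ N coincide, and w ^ i can be cancelled.
period-exists : ∀ w N → 1 ≤ w → 0 < N → Coprime N w → ∃ λ M → 0 < M × N ∣ (w ^ M ∸ 1)
period-exists w N@(suc _) w≥1 _ cop with pigeonhole (n<1+n N) (λ (i : Fin (suc N)) → (w ^ toℕ i) mod N)
... | i , j , i<j , same = M , m<n⇒0<n∸m i<j , coprime-pow-∣ N w (toℕ i) (w ^ M ∸ 1) cop N∣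
  where
  M = toℕ j ∸ toℕ i
  x = w ^ toℕ i
  wʲ≡ : w ^ toℕ j ≡ x * suc (w ^ M ∸ 1)
  wʲ≡ = trans (cong (w ^_) (sym (m+[n∸m]≡n (<⇒≤ i<j))))
          (trans (^-distribˡ-+-* w (toℕ i) M) (cong (x *_) (pow-suc-pred w M w≥1)))
  N∣ : N ∣ x * (w ^ M ∸ 1)
  N∣ = ≡-mod⇒∣ N x (w ^ M ∸ 1) (begin
    x % N                      ≡⟨ toℕ-fromℕ< (m%n<n x N) ⟨
    toℕ (x mod N)              ≡⟨ cong toℕ same ⟩
    toℕ ((w ^ toℕ j) mod N)    ≡⟨ toℕ-fromℕ< (m%n<n (w ^ toℕ j) N) ⟩
    w ^ toℕ j % N              ≡⟨ cong (_% N) wʲ≡ ⟩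
    x * suc (w ^ M ∸ 1) % N    ∎)
    where open ≡-Reasoning

sum1-cong : ∀ n f g → (∀ i → i ≤ n → f i ≡ g i) → sum1 n f ≡ sum1 n g
sum1-cong zero    f g f≗g = refl
sum1-cong (suc n) f g f≗g =
  cong₂ _+_ (sum1-cong n f g (λ i i≤n → f≗g i (m≤n⇒m≤1+n i≤n))) (f≗g (suc n) ≤-refl)

sum1-*ʳ : ∀ n f c → sum1 n (λ i → f i * c) ≡ sum1 n f * c
sum1-*ʳ zero    f c = refl
sum1-*ʳ (suc n) f c =
  trans (cong (_+ f (suc n) * c) (sum1-*ʳ n f c)) (sym (*-distribʳ-+ c (sum1 n f) (f (suc n))))

-- The base-b digits of X, padded to L digits, read through prefixes:
-- prefix n = X / b ^ (L - n) is the number formed by the first n digits.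
module Digits (b : ℕ) .{{_ : NonZero b}} (L X : ℕ) where

  prefix : ℕ → ℕ
  prefix n = _/_ X (b ^ (L ∸ n)) {{m^n≢0 b (L ∸ n)}}

  a : ℕ → ℕ
  a = digit b L X

  prefix-suc : ∀ n → n < L → prefix (suc n) ≡ prefix n * b + a (suc n)
  prefix-suc n n<L = trans (m≡m%n+[m/n]*n Y b)
    (trans (+-comm (Y % b) _) (cong (λ z → z * b + Y % b) (sym prefix≡Y/b)))
    where
    e = L ∸ suc n
    Y = prefix (suc n)
    instance
      _ : NonZero (b ^ e)
      _ = m^n≢0 b e
      _ : NonZero (b ^ e * b)
      _ = m*n≢0 (b ^ e) b
      _ : NonZero (b ^ suc e)
      _ = m^n≢0 b (suc e)
    prefix≡Y/b : prefix n ≡ Y / b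
    prefix≡Y/b = begin
      prefix n            ≡⟨ cong (λ z → _/_ X (b ^ z) {{m^n≢0 b z}}) (+-∸-assoc 1 n<L) ⟩
      X / b ^ suc e       ≡⟨ /-congʳ (*-comm b (b ^ e)) ⟩
      X / (b ^ e * b)     ≡⟨ m/n/o≡m/[n*o] X (b ^ e) b ⟨
      Y / b               ∎
      where open ≡-Reasoning

  -- window m i is the number formed by the digits a (m + 1), …, a (m + i);
  -- the Midy block A_(j+1) is window (j k) k.
  window : ℕ → ℕ → ℕ
  window m i = sum1 i (λ i' → a (m + i') * b ^ (i ∸ i'))

  window-suc : ∀ m i → window m (suc i) ≡ window m i * b + a (m + suc i)
  window-suc m i = cong₂ _+_ shift (trans (cong (λ e → a (m + suc i) * b ^ e) (n∸n≡0 i)) (*-identityʳ _))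
    where
    shift : sum1 i (λ i' → a (m + i') * b ^ (suc i ∸ i')) ≡ window m i * b
    shift = trans (sum1-cong i _ _ λ i' i'≤i → begin
        a (m + i') * b ^ (suc i ∸ i')       ≡⟨ cong (λ e → a (m + i') * b ^ e) (+-∸-assoc 1 i'≤i) ⟩
        a (m + i') * (b * b ^ (i ∸ i'))     ≡⟨ cong (a (m + i') *_) (*-comm b _) ⟩
        a (m + i') * (b ^ (i ∸ i') * b)     ≡⟨ *-assoc (a (m + i')) _ b ⟨
        a (m + i') * b ^ (i ∸ i') * b       ∎)
      (sum1-*ʳ i (λ i' → a (m + i') * b ^ (i ∸ i')) b)
      where open ≡-Reasoning

  prefix-+ : ∀ m i → m + i ≤ L → prefix (m + i) ≡ prefix m * b ^ i + window m i
  prefix-+ m zero    _ = trans (cong prefix (+-identityʳ m)) (sym (trans (+-identityʳ _) (*-identityʳ _)))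
  prefix-+ m (suc i) m+i<L = begin
      prefix (m + suc i)                                ≡⟨ cong prefix (+-suc m i) ⟩
      prefix (suc (m + i))                              ≡⟨ prefix-suc (m + i) (subst (_≤ L) (+-suc m i) m+i<L) ⟩
      prefix (m + i) * b + a (suc (m + i))              ≡⟨ cong₂ (λ x y → x * b + y) (prefix-+ m i m+i≤L)
                                                             (cong a (sym (+-suc m i))) ⟩
      (prefix m * b ^ i + window m i) * b + a (m + suc i) ≡⟨ regroup (prefix m) (b ^ i) b (window m i) _ ⟩
      prefix m * b ^ suc i + (window m i * b + a (m + suc i)) ≡⟨ cong (prefix m * b ^ suc i +_) (window-suc m i) ⟨
      prefix m * b ^ suc i + window m (suc i)           ∎
    where
    open ≡-Reasoning
    m+i≤L : m + i ≤ L
    m+i≤L = ≤-trans (+-monoʳ-≤ m (n≤1+n i)) m+i<L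
    regroup : ∀ P B b W d → (P * B + W) * b + d ≡ P * (b * B) + (W * b + d)
    regroup = solve-∀

  -- Since b ^ k ≡ 1 (mod b ^ k - 1), the prefix formed by the first j blocks of k
  -- digits is congruent to the sum of these blocks.
  prefix-blocks : ∀ k j → j * k ≤ L → X < b ^ L →
    ∃ λ c → prefix (j * k) ≡ sum1 j (block b L k X) + c * (b ^ k ∸ 1)
  prefix-blocks k zero    _     X<bᴸ = 0 , m<n⇒m/n≡0 {{m^n≢0 b L}} X<bᴸ
  prefix-blocks k (suc j) jk+k≤L X<bᴸ with prefix-blocks k j (≤-trans (m≤n+m (j * k) k) jk+k≤L) X<bᴸ
  ... | c , prefix≡ = c + prefix (j * k) , (begin
      prefix (k + j * k)                         ≡⟨ cong prefix (+-comm k (j * k)) ⟩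
      prefix (j * k + k)                         ≡⟨ prefix-+ (j * k) k (subst (_≤ L) (+-comm k (j * k)) jk+k≤L) ⟩
      prefix (j * k) * b ^ k + A                 ≡⟨ cong₂ (λ x y → x * y + A) prefix≡ (pow-suc-pred b k 1≤b) ⟩
      (Sⱼ + c * q) * suc q + A                   ≡⟨ regroup Sⱼ c q A ⟩
      Sⱼ + A + (c + (Sⱼ + c * q)) * q            ≡⟨ cong (λ z → Sⱼ + A + (c + z) * q) prefix≡ ⟨
      sum1 (suc j) (block b L k X) + (c + prefix (j * k)) * q ∎)
    where
    open ≡-Reasoning
    q = b ^ k ∸ 1
    A = window (j * k) k
    Sⱼ = sum1 j (block b L k X)
    1≤b : 1 ≤ b
    1≤b = >-nonZero⁻¹ b
    regroup : ∀ S c q A → (S + c * q) * suc q + A ≡ S + A + (c + (S + c * q)) * q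
    regroup = solve-∀

digits-≡-Midy-sum : ∀ (b : ℕ) .{{_ : NonZero b}} (L k d X : ℕ) → L ≡ k * d → X < b ^ L →
  ∃ λ c → X ≡ S b L k d X + c * (b ^ k ∸ 1)
digits-≡-Midy-sum b L k d X L≡kd X<bᴸ =
  let c , prefix≡ = prefix-blocks k d (≤-reflexive d·k≡L) X<bᴸ in c , trans (sym whole) prefix≡
  where
  open Digits b L X
  d·k≡L : d * k ≡ L
  d·k≡L = trans (*-comm d k) (sym L≡kd)
  whole : prefix (d * k) ≡ X
  whole = trans (cong (λ e → _/_ X (b ^ e) {{m^n≢0 b e}}) (trans (cong (L ∸_) d·k≡L) (n∸n≡0 L))) (n/1≡n X)

-- The Midy property, applied to x = 1, forces b ^ k - 1 to divide the period
-- X = (b ^ L - 1) / Q, hence (b ^ k - 1) Q ∣ b ^ L - 1.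
Midy⇒∣ : ∀ (b : ℕ) .{{_ : NonZero b}} (Q L d k : ℕ) → HasMidy b Q L d → L ≡ k * d →
  1 < Q → Q ∣ (b ^ L ∸ 1) → (b ^ k ∸ 1) * Q ∣ (b ^ L ∸ 1)
Midy⇒∣ b Q L d k midy L≡kd 1<Q (divides X bᴸ∸1≡XQ) =
  subst ((b ^ k ∸ 1) * Q ∣_) (sym bᴸ∸1≡XQ) (*-monoˡ-∣ Q bᵏ∸1∣X)
  where
  instance
    _ : NonZero Q
    _ = >-nonZero (<-trans z<s 1<Q)
  coprime-1 : Coprime 1 Q
  coprime-1 (g∣1 , _) = ∣1⇒≡1 g∣1
  X<bᴸ : X < b ^ L
  X<bᴸ = ≤-<-trans (≤-trans (m≤m*n X Q) (≤-reflexive (sym bᴸ∸1≡XQ)))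
           (≤-reflexive (sym (pow-suc-pred b L (>-nonZero⁻¹ b))))
  bᵏ∸1∣S : (b ^ k ∸ 1) ∣ S b L k d X
  bᵏ∸1∣S = midy k L≡kd 1 ≤-refl 1<Q coprime-1 X (trans (sym bᴸ∸1≡XQ) (sym (*-identityˡ _)))
  bᵏ∸1∣X : (b ^ k ∸ 1) ∣ X
  bᵏ∸1∣X with digits-≡-Midy-sum b L k d X L≡kd X<bᴸ
  ... | c , X≡ = subst ((b ^ k ∸ 1) ∣_) (sym X≡) (∣m∣n⇒∣m+n bᵏ∸1∣S (n∣m*n c))

module BaseMinusOne (b : ℕ) (b≥2 : 2 ≤ b) (p : ℕ) (pp : Prime p) (p∣b∸1 : p ∣ b ∸ 1) where

  E : ℕ → ℕ
  E m = b ^ m ∸ 1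

  b≥1 : 1 ≤ b
  b≥1 = <⇒≤ b≥2

  p≥2 : 2 ≤ p
  p≥2 = prime≥2 pp

  -- p ∣ b - 1 ∣ b ^ n - 1.
  p∣E : ∀ n → p ∣ E n
  p∣E n = ∣-trans p∣b∸1
    (subst₂ (λ x e → (x ∸ 1) ∣ (b ^ e ∸ 1)) (^-identityʳ b) (*-identityˡ n) (pow∸1-∣ b 1 n b≥1))

  E-* : ∀ m n → E (m * n) ≡ suc (E m) ^ n ∸ 1
  E-* m n = pow-*∸1 b m n b≥1

  E-p^suc : ∀ a → E (p ^ suc a) ≡ suc (E (p ^ a)) ^ p ∸ 1
  E-p^suc a = trans (cong E (*-comm p (p ^ a))) (E-* (p ^ a) p)

  -- p² ∣ E (p ^ (a + 1)), which makes the exponent-p step exact.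
  p²∣E-p^suc : ∀ a → p * p ∣ E (p ^ suc a)
  p²∣E-p^suc a = subst (p * p ∣_) (sym (E-p^suc a)) (lte-prime-exponent-≥ p (E (p ^ a)) (p∣E (p ^ a)))

  E-p^suc-drop : ∀ a g → p ^ suc g ∣ E (p ^ suc (suc a)) → p ^ g ∣ E (p ^ suc a)
  E-p^suc-drop a g p^g+1∣ =
    lte-prime-exponent-≤ p (E (p ^ suc a)) g pp (p²∣E-p^suc a) (subst (p ^ suc g ∣_) (E-p^suc (suc a)) p^g+1∣)

  B : ℕ
  B = b ^ p

  -- For 0 < n ≤ p the p-part of E n is below p ^ B, by size alone.
  small-exponent-bound : ∀ n g → 0 < n → n ≤ p → p ^ g ∣ E n → g < B
  small-exponent-bound n g n>0 n≤p p^g∣ = begin-strict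
    g          <⟨ lt-pow p g p≥2 ⟩
    p ^ g      ≤⟨ ∣⇒≤ {{>-nonZero E>0}} p^g∣ ⟩
    E n        <⟨ ≤-reflexive (sym (pow-suc-pred b n b≥1)) ⟩
    b ^ n      ≤⟨ ^-monoʳ-≤ b {{>-nonZero b≥1}} n≤p ⟩
    B          ∎
    where
    open ≤-Reasoning
    E>0 : 0 < E n
    E>0 = ∸-monoˡ-≤ 1 (≤-trans b≥2
      (subst (_≤ b ^ n) (*-identityʳ b) (^-monoʳ-≤ b {{>-nonZero b≥1}} n>0)))

  valuation-bound : ∀ j g → p ^ g ∣ E (p ^ j) → g < j + B
  valuation-bound zero          g p^g∣ = small-exponent-bound 1 g z<s (<⇒≤ p≥2) p^g∣
  valuation-bound (suc zero)    g p^g∣ = m≤n⇒m≤o+n 1 (small-exponent-bound (p * 1) g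
    (subst (0 <_) (sym (*-identityʳ p)) (<-trans z<s p≥2)) (≤-reflexive (*-identityʳ p)) p^g∣)
  valuation-bound (suc (suc j)) zero    _    = z<s
  valuation-bound (suc (suc j)) (suc g) p^g∣ = s<s (valuation-bound (suc j) g (E-p^suc-drop j g p^g∣))

  E-∣-E : ∀ {m n} → m ∣ n → E m ∣ E n
  E-∣-E {m} (divides q refl) = subst (λ e → E m ∣ E e) (*-comm m q) (pow∸1-∣ b m q b≥1)

  -- Let N = p ^ γ · N₀ with p ∤ N₀, and let M = p ^ c · M' with p ∤ M' be a period of b
  -- modulo N. For t > b ^ p + c, the order of b modulo p ^ t · N cannot absorb an extra
  -- factor p: otherwise a proper divisor of it would already be a period.
  module ExtraFactor (N γ N₀ M c M' : ℕ) (N≡ : N ≡ p ^ γ * N₀) (p∤N₀ : ¬ p ∣ N₀)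
                     (N∣EM : N ∣ E M) (M≡ : M ≡ p ^ c * M') (p∤M' : ¬ p ∣ M') where

    N∣E-multiple : ∀ a r → c ≤ a → N ∣ E (p ^ a * (r * M'))
    N∣E-multiple a r c≤a = ∣-trans N∣EM (E-∣-E (subst (_∣ p ^ a * (r * M')) (sym M≡)
                             (*-pres-∣ (pow-∣-pow p c≤a) (n∣m*n r))))

    exponent-large : ∀ t T a → B + c < t → t ≤ T → suc T < a + B → 2 + c ≤ a
    exponent-large t T a B+c<t t≤T T+1<a+B = +-cancelˡ-≤ B (2 + c) a (begin
      B + (2 + c)     ≡⟨ +-suc B (suc c) ⟩
      suc (B + suc c) ≡⟨ cong suc (+-suc B c) ⟩
      2 + (B + c)     ≤⟨ s≤s (≤-trans B+c<t t≤T) ⟩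
      suc T           ≤⟨ <⇒≤ T+1<a+B ⟩
      a + B           ≡⟨ +-comm a B ⟩
      B + a           ∎)
      where open ≤-Reasoning

    no-extra-factor : ∀ t → B + c < t → ∀ L → IsOrder b (p ^ t * N) L → ¬ p ^ suc (t + γ) ∣ E L
    no-extra-factor t B+c<t L ord@(L>0 , _) p^T+1∣EL with p-split p p≥2 L L>0
    ... | a , r , L≡pᵃr , p∤r = descend a L≡pᵃr a≥c+2 p^T+1∣E-pᵃ
      where
      T = t + γ
      p^T+1∣E-pᵃ : p ^ suc T ∣ E (p ^ a)
      p^T+1∣E-pᵃ = lte-coprime-exponent p (E (p ^ a)) r (suc T) pp (p∣E (p ^ a)) p∤r
                     (subst (p ^ suc T ∣_) (trans (cong E L≡pᵃr) (E-* (p ^ a) r)) p^T+1∣EL)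
      a≥c+2 : 2 + c ≤ a
      a≥c+2 = exponent-large t T a B+c<t (m≤m+n t γ) (valuation-bound a (suc T) p^T+1∣E-pᵃ)
      -- With a = a' + 2, the multiple m = p ^ (a' + 1) · r · M' of the period is a period
      -- modulo p ^ t · N, yet L ∤ m.
      descend : ∀ a → L ≡ p ^ a * r → 2 + c ≤ a → p ^ suc T ∣ E (p ^ a) → ⊥
      descend (suc (suc a')) L≡ (s≤s (s≤s c≤a')) p^T+1∣ =
        p∤M' (pow-suc-∣⇒∣ p (suc a') r M' {{prime⇒nonZero pp}} {{∤⇒nonZero r p∤r}} L∣m)
        where
        m = p ^ suc a' * (r * M')
        p^T∣Em : p ^ T ∣ E m
        p^T∣Em = ∣-trans (E-p^suc-drop a' T p^T+1∣) (E-∣-E (m∣m*n {p ^ suc a'} (r * M')))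
        Q∣Em : p ^ t * N ∣ E m
        Q∣Em = subst (λ n → p ^ t * n ∣ E m) (sym N≡)
                 (prime-pow-*-∣ p t γ N₀ (E m) pp p∤N₀ p^T∣Em
                   (subst (_∣ E m) N≡ (N∣E-multiple (suc a') r (m≤n⇒m≤1+n c≤a'))))
        L∣m : p ^ suc (suc a') * r ∣ m
        L∣m = subst (_∣ m) L≡ (order-∣ b (p ^ t * N) L m b≥1 ord Q∣Em)

    p^T+1∣pQ : ∀ t → p ^ suc (t + γ) ∣ p * (p ^ t * N)
    p^T+1∣pQ t = subst (_∣ p * (p ^ t * N)) (cong (p *_) (sym (^-distribˡ-+-* p t γ)))
                   (*-monoʳ-∣ p (*-monoʳ-∣ (p ^ t) (subst (p ^ γ ∣_) (sym N≡) (m∣m*n N₀))))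

theorem2p9 : (b : ℕ) .{{_ : NonZero b}} → 2 ≤ b →
    (N : ℕ) → 0 < N → Coprime N b →
    (p : ℕ) → Prime p → p ∣ (b ∸ 1) →
    ∃[ s ] (0 < s × (∀ t → s < t → ∀ L → IsOrder b (p ^ t * N) L →
      ∀ d → ¬ InMidySet b (p ^ t * N) L d))
theorem2p9 b b≥2 N N>0 cop p pp p∣b∸1
  with p-split p (prime≥2 pp) N N>0 | period-exists b N (<⇒≤ b≥2) N>0 cop
... | γ , N₀ , N≡ , p∤N₀ | M , M>0 , N∣EM with p-split p (prime≥2 pp) M M>0
... | c , M' , M≡ , p∤M' = B + c , ≤-trans (m^n>0 b p) (m≤m+n B c) , no-Midy
  where
  open BaseMinusOne b b≥2 p pp p∣b∸1
  open ExtraFactor N γ N₀ M c M' N≡ p∤N₀ N∣EM M≡ p∤M'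
  no-Midy : ∀ t → B + c < t → ∀ L → IsOrder b (p ^ t * N) L → ∀ d → ¬ InMidySet b (p ^ t * N) L d
  no-Midy t B+c<t L ord@(_ , Q∣EL , _) d (_ , divides k L≡kd , midy) =
    no-extra-factor t B+c<t L ord (∣-trans (p^T+1∣pQ t) (∣-trans (*-monoˡ-∣ Q (p∣E k)) bᵏ∸1·Q∣EL))
    where
    Q = p ^ t * N
    1<Q : 1 < Q
    1<Q = ≤-trans (≤-trans p≥2 (subst (_≤ p ^ t) (*-identityʳ p)
                                 (^-monoʳ-≤ p {{prime⇒nonZero pp}} (≤-trans z<s B+c<t))))
                  (m≤m*n (p ^ t) N {{>-nonZero N>0}})
    bᵏ∸1·Q∣EL : (b ^ k ∸ 1) * Q ∣ E L
    bᵏ∸1·Q∣EL = Midy⇒∣ b Q L d k midy L≡kd 1<Q Q∣EL
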